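{- For every $U\in\tau_{\mathsf{h}(X)}$ we have ${\downarrow}U\in\tau_{\mathsf{h}(X)}$.
   Context: Standing setting: $X=\langle X;\le\rangle$ is a well-ordered tree (a poset with a least element, whose principal downsets ${\downarrow}x$ are chains, and with no infinite descending chain) in which every nonempty chain has a supremum. For $x\in X$, $\mathsf{h}(x)$ is the unique ordinal $\alpha$ with $\langle{\downarrow}x\smallsetminus\{x\};<\rangle\cong\langle\alpha;\in\rangle$; $\mathsf{h}(X)$ is the least ordinal $\alpha$ with $\mathsf{h}(x)\le\alpha$ for all $x$. Write $X_\alpha=\{x:\mathsf{h}(x)=\alpha\}$, $X_{\ast\alpha}=\{x:\mathsf{h}(x)\ast\alpha\}$ for $\ast\in\{\le,<,\ge,>\}$, and ${\uparrow_\alpha}Y=X_{\le\alpha}\cap{\uparrow}Y$. Topologies $\tau_\alpha$ on $X_{\le\alpha}$ are defined by recursion: $\tau_0$ is the unique topology on the singleton $X_{\le 0}$. Given $\tau_\alpha$, let $P_\alpha=\{x\in X_\alpha:\exists y\in X_{\alpha+1},\ x<y\}$, fix for each $x\in P_\alpha$ a chosen $x^+\in X_{\alpha+1}$ with $x<x^+$, let $S_{\alpha+1}=X_{\alpha+1}\smallsetminus\{x^+:x\in P_\alpha\}$, and let $\tau_{\alpha+1}$ be the topology on $X_{\le\alpha+1}$ generated by the subbase $\mathcal{S}_{\alpha+1}$ consisting of: $\{x\}$ for $x\in S_{\alpha+1}$; ${\downarrow}x$ for $x\in P_\alpha$; and $(V\cup{\uparrow_{\alpha+1}}(V\cap X_\alpha))\smallsetminus{\downarrow}Z$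 for every $V\in\tau_\alpha$ and every finite $Z\subseteq P_\alpha\cup S_{\alpha+1}$. For a limit ordinal $\alpha$, $\tau_\alpha$ is the topology on $X_{\le\alpha}$ generated by the subbase $\mathcal{S}_\alpha=\{V\cup{\uparrow_\alpha}(V\cap X_\beta):\beta<\alpha,\ V\in\tau_\beta\}$. Note $X=X_{\le\mathsf{h}(X)}$. -}

module Defs where

open import Level using (0ℓ) renaming (suc to lsuc)
open import Data.Product using (Σ; ∃; ∃-syntax; _×_; _,_; proj₁; proj₂)
open import Data.Sum using (_⊎_)
open import Data.List using (List)
open import Data.List.Relation.Unary.All using (All)
open import Data.List.Relation.Unary.Any using (Any)
open import Relation.Binary.PropositionalEquality using (_≡_)
open import Relation.Nullary using (¬_)
open import Relation.Unary using (Pred; _∈_; _⊆_; _≐_; _∩_; _∪_; _∖_)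
open import Induction.WellFounded using (WellFounded; WfRec)
import Induction.WellFounded as WF
open import Function.Bundles using (_⇔_)

SetOf : Set → Set₁
SetOf X = Pred X 0ℓ

record WOTree : Set₁ where
  field
    X         : Set
    _≤_       : X → X → Set
    ≤-refl    : ∀ x → x ≤ x
    ≤-trans   : ∀ {x y z} → x ≤ y → y ≤ z → x ≤ z
    ≤-antisym : ∀ {x y} → x ≤ y → y ≤ x → x ≡ y
    root      : X
    root-least : ∀ x → root ≤ x
    downset-chain : ∀ {x y z} → y ≤ x → z ≤ x → (y ≤ z ⊎ z ≤ y)

  _<_ : X → X → Set
  x < y = x ≤ y × ¬ (x ≡ y)

  IsChain : SetOf X → Set
  IsChain C = ∀ {a b} → a ∈ C → b ∈ C → (a ≤ b ⊎ b ≤ a)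

  IsSup : SetOf X → X → Set
  IsSup C s = (∀ {c} → c ∈ C → c ≤ s) × (∀ u → (∀ {c} → c ∈ C → c ≤ u) → s ≤ u)

  field
    <-wf      : WellFounded _<_
    chain-sup : ∀ (C : SetOf X) → IsChain C → (∃ λ c → c ∈ C) → ∃ (IsSup C)

-- Ordinals (an arbitrary well-ordered type, big enough to contain h(X)),
-- the height function h and the ordinal h(X).

record Heights (T : WOTree) : Set₁ where
  open WOTree T
  field
    O          : Set
    _<ₒ_       : O → O → Set
    <ₒ-irrefl  : ∀ a → ¬ (a <ₒ a)
    <ₒ-trans   : ∀ {a b c} → a <ₒ b → b <ₒ c → a <ₒ c
    <ₒ-tri     : ∀ a b → (a <ₒ b ⊎ a ≡ b ⊎ b <ₒ a)
    <ₒ-wf      : WellFounded _<ₒ_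

  _≤ₒ_ : O → O → Set
  a ≤ₒ b = a <ₒ b ⊎ a ≡ b

  IsOrderIso : (x : X) (α : O) → (Σ X (_< x) → Σ O (_<ₒ α)) → Set
  IsOrderIso x α f =
      (∀ a b → (proj₁ a < proj₁ b) ⇔ (proj₁ (f a) <ₒ proj₁ (f b)))
    × (∀ (β : Σ O (_<ₒ α)) → ∃ λ (a : Σ X (_< x)) → proj₁ (f a) ≡ proj₁ β)

  field
    h     : X → O
    h-iso : ∀ x → ∃ λ f → IsOrderIso x (h x) f
    hX       : O
    hX-bound : ∀ x → h x ≤ₒ hX
    hX-least : ∀ α → (∀ x → h x ≤ₒ α) → hX ≤ₒ α

module Construction (T : WOTree) (H : Heights T) (plus : WOTree.X T → WOTree.X T) where
  open WOTree T
  open Heights H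

  IsSucc : O → O → Set
  IsSucc β α = β <ₒ α × (∀ γ → β <ₒ γ → α ≤ₒ γ)

  IsLimit : O → Set
  IsLimit α = (∃ λ γ → γ <ₒ α) × ¬ (∃ λ β → IsSucc β α)

  Lev : O → SetOf X
  Lev α x = h x ≡ α

  Le : O → SetOf X
  Le α x = h x ≤ₒ α

  ↓ : X → SetOf X
  ↓ x z = z ≤ x

  ↓L : List X → SetOf X
  ↓L Z z = Any (z ≤_) Z

  ↓S : SetOf X → SetOf X
  ↓S U z = ∃ λ u → u ∈ U × z ≤ u

  ↑S : SetOf X → SetOf X
  ↑S Y z = ∃ λ y → y ∈ Y × y ≤ z

  ↑[_] : O → SetOf X → SetOf X
  ↑[ α ] Y = Le α ∩ ↑S Y

  P : O → SetOf X
  P β x = h x ≡ β × (∃ λ y → IsSucc β (h y) × x < y)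

  -- the choice x ↦ x⁺ (only its values on P_β matter)
  PlusSpec : Set
  PlusSpec = ∀ x → (∃ λ y → IsSucc (h x) (h y) × x < y)
                 → IsSucc (h x) (h (plus x)) × x < plus x

  S : O → O → SetOf X
  S β α y = h y ≡ α × ¬ (∃ λ x → x ∈ P β × plus x ≡ y)

  Topo : Set₂
  Topo = Pred (SetOf X) (lsuc 0ℓ)

  -- topology on Y generated by the subbase 𝒮: unions of finite
  -- intersections (the empty intersection being Y itself)
  Generated : SetOf X → Topo → Topo
  Generated Y 𝒮 U =
      U ⊆ Y
    × (∀ {x} → x ∈ U → ∃ λ (Ws : List (SetOf X)) →
          All (_∈ 𝒮) Ws × All (x ∈_) Ws
        × (∀ {y} → y ∈ Y → All (y ∈_) Ws → y ∈ U))

  Sub : (α : O) → WfRec _<ₒ_ (λ _ → Topo) α → Topo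
  Sub α rec W =
      (∃ λ β → Σ (IsSucc β α) λ s →
          (∃ λ x → x ∈ S β α × W ≐ (_≡ x))
        ⊎ (∃ λ x → x ∈ P β × W ≐ ↓ x)
        ⊎ (∃ λ V → V ∈ rec (proj₁ s) × ∃ λ (Z : List X) →
              All (λ z → z ∈ P β ⊎ z ∈ S β α) Z
            × W ≐ ((V ∪ ↑[ α ] (V ∩ Lev β)) ∖ ↓L Z)))
    ⊎ (IsLimit α × ∃ λ β → Σ (β <ₒ α) λ p → ∃ λ V →
          V ∈ rec p × W ≐ (V ∪ ↑[ α ] (V ∩ Lev β)))

  τ : O → Topo
  τ = WF.All.wfRec <ₒ-wf (lsuc (lsuc 0ℓ)) (λ _ → Topo)
        (λ α rec → Generated (Le α) (Sub α rec))

-- If z < u for some u ∈ U, then z has a successor-level point above it, so z ∈ P_{h z} and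
-- ↓z is subbasic in τ_{h z + 1}; it stays open in every later τ_α, because for β > h z the
-- subbasic sets ↓z ∪ ↑_α(↓z ∩ X_β) and (↓z ∪ ↑_α(↓z ∩ X_β)) ∖ ↓∅ are just ↓z again.
-- Hence ↓U = U ∪ ⋃ {↓z : z < u ∈ U} is a union of open sets.
module Submission where

open import Defs
open import Level using (0ℓ; lift; lower) renaming (suc to lsuc)
open import Axiom.ExcludedMiddle using (ExcludedMiddle)
open import Relation.Unary using (_∈_; _⊆_; _≐_; _∩_; _∪_; _∖_)
import Relation.Binary.Construct.On as On
open import Data.Product using (Σ; ∃; _×_; _,_; proj₁; proj₂)
open import Data.Sum using (inj₁; inj₂)
open import Data.Empty using (⊥-elim)
open import Data.List using ([])
open import Data.List.Relation.Unary.All as All using ([]; _∷_)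
open import Relation.Binary.PropositionalEquality using (_≡_; refl; sym; trans; subst)
open import Relation.Nullary using (¬_; yes; no)
open import Relation.Nullary.Decidable using (map′)
open import Function.Base using (_∘_; id; _on_)
open import Function.Bundles using (Equivalence)
open import Induction.WellFounded using (WellFounded; WfRec; Acc; acc)
import Induction.WellFounded as WF

em-lower : ExcludedMiddle (lsuc 0ℓ) → ExcludedMiddle 0ℓ
em-lower em = map′ lower lift em

module Height (T : WOTree) (H : Heights T) where
  open WOTree T
  open Heights H

  <ₒ-≤ₒ-trans : ∀ {a b c} → a <ₒ b → b ≤ₒ c → a <ₒ c
  <ₒ-≤ₒ-trans a<b (inj₁ b<c) = <ₒ-trans a<b b<c
  <ₒ-≤ₒ-trans a<b (inj₂ refl) = a<b

  ≤ₒ-<ₒ-trans : ∀ {a b c} → a ≤ₒ b → b <ₒ c → a <ₒ c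
  ≤ₒ-<ₒ-trans (inj₁ a<b) b<c = <ₒ-trans a<b b<c
  ≤ₒ-<ₒ-trans (inj₂ refl) b<c = b<c

  ≤ₒ-trans : ∀ {a b c} → a ≤ₒ b → b ≤ₒ c → a ≤ₒ c
  ≤ₒ-trans (inj₁ a<b) b≤c = inj₁ (<ₒ-≤ₒ-trans a<b b≤c)
  ≤ₒ-trans (inj₂ refl) b≤c = b≤c

  ≮ₒ∧≯ₒ⇒≡ : ∀ {a b} → ¬ a <ₒ b → ¬ b <ₒ a → a ≡ b
  ≮ₒ∧≯ₒ⇒≡ {a} {b} a≮b b≮a with <ₒ-tri a b
  ... | inj₁ a<b = ⊥-elim (a≮b a<b)
  ... | inj₂ (inj₁ a≡b) = a≡b
  ... | inj₂ (inj₂ b<a) = ⊥-elim (b≮a b<a)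

  <-irrefl : ∀ {x} → ¬ x < x
  <-irrefl (_ , x≢x) = x≢x refl

  <-trans : ∀ {x y z} → x < y → y < z → x < z
  <-trans (x≤y , _) (y≤z , y≢z) = ≤-trans x≤y y≤z , λ { refl → y≢z (≤-antisym y≤z x≤y) }

  record IsSegmentIso {A : Set} (_⊏_ : A → A → Set) (g : A → O) (α : O) : Set where
    field
      preserves : ∀ {u v} → u ⊏ v → g u <ₒ g v
      reflects  : ∀ {u v} → g u <ₒ g v → u ⊏ v
      bounded   : ∀ u → g u <ₒ α
      onto      : ∀ {β} → β <ₒ α → ∃ λ u → g u ≡ β

    incomparable⇒≡ : ∀ {u v} → ¬ u ⊏ v → ¬ v ⊏ u → g u ≡ g v
    incomparable⇒≡ u⋢v v⋢u = ≮ₒ∧≯ₒ⇒≡ (u⋢v ∘ reflects) (v⋢u ∘ reflects)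

  open IsSegmentIso

  module _ {A : Set} {_⊏_ : A → A → Set} where

    segmentIso-value-≮ : ∀ {g₁ g₂ α₁ α₂} → IsSegmentIso _⊏_ g₁ α₁ → IsSegmentIso _⊏_ g₂ α₂ →
                         ∀ {u} → (∀ {v} → v ⊏ u → g₁ v ≡ g₂ v) → ¬ g₁ u <ₒ g₂ u
    segmentIso-value-≮ {g₁} {g₂} i₁ i₂ {u} ih g₁u<g₂u =
      let (v , g₂v≡g₁u) = onto i₂ (<ₒ-trans g₁u<g₂u (bounded i₂ u))
          v⊏u = reflects i₂ (subst (_<ₒ g₂ u) (sym g₂v≡g₁u) g₁u<g₂u)
      in <ₒ-irrefl _ (subst (_<ₒ g₁ u) (trans (ih v⊏u) g₂v≡g₁u) (preserves i₁ v⊏u))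

    segmentIso-unique : WellFounded _⊏_ → ∀ {g₁ g₂ α₁ α₂} →
                        IsSegmentIso _⊏_ g₁ α₁ → IsSegmentIso _⊏_ g₂ α₂ → ∀ u → g₁ u ≡ g₂ u
    segmentIso-unique wf {g₁} {g₂} i₁ i₂ = WF.All.wfRec wf 0ℓ (λ u → g₁ u ≡ g₂ u)
      λ u ih → ≮ₒ∧≯ₒ⇒≡ (segmentIso-value-≮ i₁ i₂ ih) (segmentIso-value-≮ i₂ i₁ (sym ∘ ih))

    segmentIso-bound-≮ : ∀ {g₁ g₂ α₁ α₂} → IsSegmentIso _⊏_ g₁ α₁ → IsSegmentIso _⊏_ g₂ α₂ →
                         (∀ u → g₁ u ≡ g₂ u) → ¬ α₁ <ₒ α₂
    segmentIso-bound-≮ {α₁ = α₁} i₁ i₂ g₁≡g₂ α₁<α₂ =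
      let (v , g₂v≡α₁) = onto i₂ α₁<α₂
      in <ₒ-irrefl α₁ (subst (_<ₒ α₁) (trans (g₁≡g₂ v) g₂v≡α₁) (bounded i₁ v))

    segmentIso-bound-unique : WellFounded _⊏_ → ∀ {g₁ g₂ α₁ α₂} →
                              IsSegmentIso _⊏_ g₁ α₁ → IsSegmentIso _⊏_ g₂ α₂ → α₁ ≡ α₂
    segmentIso-bound-unique wf i₁ i₂ =
      ≮ₒ∧≯ₒ⇒≡ (segmentIso-bound-≮ i₁ i₂ g₁≡g₂) (segmentIso-bound-≮ i₂ i₁ (sym ∘ g₁≡g₂))
      where g₁≡g₂ = segmentIso-unique wf i₁ i₂

  Below : X → Set
  Below x = Σ X (_< x)

  Below-weaken : ∀ {a b} → a < b → Below a → Below b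
  Below-weaken a<b (c , c<a) = c , <-trans c<a a<b

  rank : ∀ x → Below x → O
  rank x = proj₁ ∘ proj₁ (h-iso x)

  rank-isSegmentIso : ∀ x → IsSegmentIso (_<_ on proj₁) (rank x) (h x)
  rank-isSegmentIso x = record
    { preserves = λ {u} {v} → Equivalence.to (iso u v)
    ; reflects  = λ {u} {v} → Equivalence.from (iso u v)
    ; bounded   = λ u → proj₂ (proj₁ (h-iso x) u)
    ; onto      = λ {β} β<hx → surj (β , β<hx)
    }
    where
    iso = proj₁ (proj₂ (h-iso x))
    surj = proj₂ (proj₂ (h-iso x))

  rank-restriction : ∀ {a b} (a<b : a < b) →
                     IsSegmentIso (_<_ on proj₁) (rank b ∘ Below-weaken a<b) (rank b (a , a<b))
  rank-restriction {a} {b} a<b = record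
    { preserves = preserves rb
    ; reflects  = reflects rb
    ; bounded   = λ (_ , c<a) → preserves rb c<a
    ; onto      = onto′
    }
    where
    rb = rank-isSegmentIso b
    onto′ : ∀ {β} → β <ₒ rank b (a , a<b) → ∃ λ u → rank b (Below-weaken a<b u) ≡ β
    onto′ β<ra with onto rb (<ₒ-trans β<ra (bounded rb (a , a<b)))
    ... | (c , c<b) , rc≡β =
      let c<a = reflects rb (subst (_<ₒ rank b (a , a<b)) (sym rc≡β) β<ra)
      in (c , c<a) , trans (incomparable⇒≡ rb <-irrefl <-irrefl) rc≡β

  h≡rank : ∀ {a b} (a<b : a < b) → h a ≡ rank b (a , a<b)
  h≡rank a<b = segmentIso-bound-unique (On.wellFounded proj₁ <-wf)
                 (rank-isSegmentIso _) (rank-restriction a<b)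

  h-mono-< : ∀ {a b} → a < b → h a <ₒ h b
  h-mono-< {b = b} a<b =
    subst (_<ₒ h b) (sym (h≡rank a<b)) (bounded (rank-isSegmentIso b) (_ , a<b))

  h-below : ∀ {b γ} → γ <ₒ h b → ∃ λ z → z < b × h z ≡ γ
  h-below γ<hb with onto (rank-isSegmentIso _) γ<hb
  ... | (z , z<b) , rz≡γ = z , z<b , trans (h≡rank z<b) rz≡γ

module TopologyUnfolding (T : WOTree) (H : Heights T) (plus : WOTree.X T → WOTree.X T) where
  open WOTree T
  open Heights H
  open Construction T H plus

  Generated-mono : ∀ {Y 𝒮 𝒮′} → 𝒮 ⊆ 𝒮′ → Generated Y 𝒮 ⊆ Generated Y 𝒮′
  Generated-mono 𝒮⊆𝒮′ (U⊆Y , basic) = U⊆Y , λ x∈U →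
    let (Ws , Ws-sub , x∈Ws , ⋂Ws⊆U) = basic x∈U
    in Ws , All.map 𝒮⊆𝒮′ Ws-sub , x∈Ws , ⋂Ws⊆U

  Generated-local : ∀ {Y 𝒮 W} → W ⊆ Y →
                    (∀ {z} → z ∈ W → ∃ λ V → V ∈ Generated Y 𝒮 × z ∈ V × V ⊆ W) →
                    W ∈ Generated Y 𝒮
  Generated-local W⊆Y nbhd = W⊆Y , λ z∈W →
    let (V , (_ , V-basic) , z∈V , V⊆W) = nbhd z∈W
        (Ws , Ws-sub , z∈Ws , ⋂Ws⊆V) = V-basic z∈V
    in Ws , Ws-sub , z∈Ws , λ y∈Y y∈Ws → V⊆W (⋂Ws⊆V y∈Y y∈Ws)

  Sub-mono : ∀ α {rec rec′ : WfRec _<ₒ_ (λ _ → Topo) α} →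
             (∀ {β} (β<α : β <ₒ α) → rec β<α ⊆ rec′ β<α) → Sub α rec ⊆ Sub α rec′
  Sub-mono α m (inj₁ (β , s , inj₁ single)) = inj₁ (β , s , inj₁ single)
  Sub-mono α m (inj₁ (β , s , inj₂ (inj₁ down))) = inj₁ (β , s , inj₂ (inj₁ down))
  Sub-mono α m (inj₁ (β , s , inj₂ (inj₂ (V , V-open , rest)))) =
    inj₁ (β , s , inj₂ (inj₂ (V , m (proj₁ s) V-open , rest)))
  Sub-mono α m (inj₂ (lim , β , β<α , V , V-open , rest)) = inj₂ (lim , β , β<α , V , m β<α V-open , rest)

  τ-step : (α : O) → WfRec _<ₒ_ (λ _ → Topo) α → Topo
  τ-step α rec = Generated (Le α) (Sub α rec)

  τ-below : (α : O) → Acc _<ₒ_ α → WfRec _<ₒ_ (λ _ → Topo) α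
  τ-below = WF.Some.wfRecBuilder (λ _ → Topo) τ-step

  -- τ α is definitionally  τ-step α (τ-below α (<ₒ-wf α)), but the recursion runs on the
  -- accessibility proof, so the predecessors' topologies have to be transported.
  τ-below-irrelevant : ∀ α (q q′ : Acc _<ₒ_ α) {β} (β<α : β <ₒ α) → τ-below α q β<α ⊆ τ-below α q′ β<α
  τ-below-irrelevant α (acc rs) (acc rs′) β<α =
    Generated-mono (Sub-mono _ (τ-below-irrelevant _ (rs β<α) (rs′ β<α)))

  τ-below-intro : ∀ α (q : Acc _<ₒ_ α) {β} (β<α : β <ₒ α) → τ β ⊆ τ-below α q β<α
  τ-below-intro α (acc rs) β<α =
    Generated-mono (Sub-mono _ (τ-below-irrelevant _ (<ₒ-wf _) (rs β<α)))

  subbasic⇒τ : ∀ α {W} → Sub α (λ {β} _ → τ β) W → W ⊆ Le α → W ∈ τ α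
  subbasic⇒τ α W-sub W⊆Le =
    Generated-mono (Sub-mono α (τ-below-intro α (<ₒ-wf α)))
      (W⊆Le , λ x∈W → _ , W-sub ∷ [] , x∈W ∷ [] , λ { _ (y∈W ∷ []) → y∈W })

module Downsets (em : ExcludedMiddle 0ℓ) (T : WOTree) (H : Heights T)
                (plus : WOTree.X T → WOTree.X T) where
  open WOTree T
  open Heights H
  open Construction T H plus
  open Height T H
  open TopologyUnfolding T H plus

  h-mono-≤ : ∀ {a b} → a ≤ b → h a ≤ₒ h b
  h-mono-≤ {a} {b} a≤b with em {a ≡ b}
  ... | yes refl = inj₂ refl
  ... | no a≢b = inj₁ (h-mono-< (a≤b , a≢b))

  ↓⊆Le : ∀ {y α} → h y ≤ₒ α → ↓ y ⊆ Le α
  ↓⊆Le hy≤α z≤y = ≤ₒ-trans (h-mono-≤ z≤y) hy≤α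

  ↓≐↓∪↑ : ∀ {y α β} → h y <ₒ β → ↓ y ≐ (↓ y ∪ ↑[ α ] (↓ y ∩ Lev β))
  ↓≐↓∪↑ hy<β = inj₁ , λ
    { (inj₁ z≤y) → z≤y
    ; (inj₂ (_ , w , (w≤y , hw≡β) , _)) →
        ⊥-elim (<ₒ-irrefl _ (subst (_<ₒ _) hw≡β (≤ₒ-<ₒ-trans (h-mono-≤ w≤y) hy<β)))
    }

  ≐-∖-↓L[] : ∀ {A B : SetOf X} → A ≐ B → A ≐ (B ∖ ↓L [])
  ≐-∖-↓L[] (A⊆B , B⊆A) = (λ a → A⊆B a , λ ()) , (λ (b , _) → B⊆A b)

  nothing-between⇒IsSucc : ∀ {a b} → a <ₒ b → ¬ (∃ λ c → a <ₒ c × c <ₒ b) → IsSucc a b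
  nothing-between⇒IsSucc {a} {b} a<b nothing = a<b , b≤
    where
    b≤ : ∀ c → a <ₒ c → b ≤ₒ c
    b≤ c a<c with <ₒ-tri c b
    ... | inj₁ c<b = ⊥-elim (nothing (c , a<c , c<b))
    ... | inj₂ (inj₁ c≡b) = inj₂ (sym c≡b)
    ... | inj₂ (inj₂ b<c) = inj₁ b<c

  successor-level-above : ∀ {x y α} → y < x → IsSucc (h y) α → ∃ λ z → h z ≡ α × y < z
  successor-level-above {x} {y} {α} y<x (hy<α , α≤) = level-α (α≤ (h x) (h-mono-< y<x))
    where
    y≤ : ∀ {z} → z < x → h z ≡ α → y ≤ z
    y≤ z<x hz≡α with downset-chain (proj₁ y<x) (proj₁ z<x)
    ... | inj₁ y≤z = y≤z
    ... | inj₂ z≤y =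
      ⊥-elim (<ₒ-irrefl _ (<ₒ-≤ₒ-trans hy<α (subst (_≤ₒ h y) hz≡α (h-mono-≤ z≤y))))
    y≢ : ∀ {z} → h z ≡ α → ¬ y ≡ z
    y≢ hz≡α refl = <ₒ-irrefl _ (subst (h y <ₒ_) (sym hz≡α) hy<α)
    level-α : α ≤ₒ h x → ∃ λ z → h z ≡ α × y < z
    level-α (inj₂ α≡hx) = x , sym α≡hx , y<x
    level-α (inj₁ α<hx) =
      let (z , z<x , hz≡α) = h-below α<hx in z , hz≡α , y≤ z<x hz≡α , y≢ hz≡α

  ↓-open-at-successor : ∀ {x y α} → y < x → IsSucc (h y) α → ↓ y ∈ τ α
  ↓-open-at-successor {y = y} y<x y+1≡α =
    subbasic⇒τ _ (inj₁ (h y , y+1≡α , inj₂ (inj₁ (y , y∈P , id , id)))) (↓⊆Le (inj₁ (proj₁ y+1≡α)))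
    where
    y∈P : y ∈ P (h y)
    y∈P = let (z , hz≡α , y<z) = successor-level-above y<x y+1≡α
          in refl , z , subst (IsSucc (h y)) (sym hz≡α) y+1≡α , y<z

  ↓-open : ∀ {x y} → y < x → ∀ {α} → h y <ₒ α → ↓ y ∈ τ α
  ↓-open {y = y} y<x = go (<ₒ-wf _)
    where
    go : ∀ {α} → Acc _<ₒ_ α → h y <ₒ α → ↓ y ∈ τ α
    go {α} (acc rs) hy<α with em {∃ λ β → IsSucc β α}
    ... | yes (β , β+1≡α) with <ₒ-tri (h y) β
    ...   | inj₂ (inj₁ refl) = ↓-open-at-successor y<x β+1≡α
    ...   | inj₂ (inj₂ β<hy) = ⊥-elim (<ₒ-irrefl _ (<ₒ-≤ₒ-trans hy<α (proj₂ β+1≡α (h y) β<hy)))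
    ...   | inj₁ hy<β = subbasic⇒τ α
      (inj₁ (β , β+1≡α , inj₂ (inj₂ (↓ y , go (rs (proj₁ β+1≡α)) hy<β , [] , [] ,
        ≐-∖-↓L[] (↓≐↓∪↑ hy<β)))))
      (↓⊆Le (inj₁ hy<α))
    go {α} (acc rs) hy<α | no not-succ with em {∃ λ β → h y <ₒ β × β <ₒ α}
    ... | yes (β , hy<β , β<α) = subbasic⇒τ α
      (inj₂ (((h y , hy<α) , not-succ) , β , β<α , ↓ y , go (rs β<α) hy<β , ↓≐↓∪↑ hy<β))
      (↓⊆Le (inj₁ hy<α))
    ... | no nothing = ⊥-elim (not-succ (h y , nothing-between⇒IsSucc hy<α nothing))

proposition8p1 : ExcludedMiddle (Level.suc 0ℓ)
    → (T : WOTree) (H : Heights T) (plus : WOTree.X T → WOTree.X T)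
    → Construction.PlusSpec T H plus
    → ∀ (U : SetOf (WOTree.X T))
    → U ∈ Construction.τ T H plus (Heights.hX H)
    → Construction.↓S T H plus U ∈ Construction.τ T H plus (Heights.hX H)
proposition8p1 em T H plus _ U U-open@(U⊆Le , _) = Generated-local ↓U⊆Le nbhd
  where
  open WOTree T
  open Heights H
  open Construction T H plus
  open Height T H
  open TopologyUnfolding T H plus
  open Downsets (em-lower em) T H plus

  ↓U⊆Le : ↓S U ⊆ Le hX
  ↓U⊆Le (u , u∈U , z≤u) = ↓⊆Le (U⊆Le u∈U) z≤u

  nbhd : ∀ {z} → z ∈ ↓S U → ∃ λ V → V ∈ τ hX × z ∈ V × V ⊆ ↓S U
  nbhd {z} (u , u∈U , z≤u) with em-lower em {z ≡ u}
  ... | yes refl = U , U-open , u∈U , λ {w} w∈U → w , w∈U , ≤-refl w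
  ... | no z≢u = ↓ z , ↓-open z<u (<ₒ-≤ₒ-trans (h-mono-< z<u) (U⊆Le u∈U)) , ≤-refl z ,
                 λ w≤z → u , u∈U , ≤-trans w≤z z≤u
    where z<u = z≤u , z≢u
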